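{- For every integer $n>1$, the number $11\times(10^{n}-1)$ is a Ball magic number.
   Context: Ball magic number: let $N\ge 2$ and let $x$ be a positive integer with exactly $N$ decimal digits, $x=a_{N-1}\dots a_1a_0$ with $a_{N-1}\neq 0$, which is not a palindrome. Its reverse $x'$ is the integer whose decimal digit string is $a_0a_1\dots a_{N-1}$ (leading zeros allowed). Let $y=|x-x'|$, written as an $N$-digit string $b_{N-1}\dots b_0$ (padding with leading zeros if necessary), and let $y'$ be the integer with digit string $b_0b_1\dots b_{N-1}$. The nonzero integer $B=y+y'$ is called the Ball magic number obtained from $x$; a Ball magic number is any integer obtained this way from some such $x$. -}

module Defs where

open import Data.Nat using (ℕ; zero; suc; _+_; _*_; _≤_; ∣_-_∣)
open import Data.Nat.DivMod using (_/_; _%_)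
open import Data.Fin using (Fin; toℕ; zero)
open import Data.Vec using (Vec; []; _∷_; reverse; head)
open import Data.Product using (Σ; _×_; ∃; ∃-syntax)
open import Relation.Binary.PropositionalEquality using (_≡_; _≢_)
open import Data.Fin using (fromℕ<)
open import Data.Nat.DivMod using (m%n<n)

-- A decimal digit string of length N, written most-significant digit first:
-- the vector  a_{N-1} ∷ … ∷ a_0 ∷ [].
Digits : ℕ → Set
Digits N = Vec (Fin 10) N

valueAcc : ∀ {N} → ℕ → Digits N → ℕ
valueAcc acc [] = acc
valueAcc acc (d ∷ ds) = valueAcc (acc * 10 + toℕ d) ds

value : ∀ {N} → Digits N → ℕ
value ds = valueAcc 0 ds

-- The N-digit string (most-significant first, padded with leading zeros)
-- of the last N decimal digits of y.  For y < 10^N this is the N-digit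
-- representation of y.
toDigitsRev : (N : ℕ) → ℕ → Vec (Fin 10) N
toDigitsRev zero y = []
toDigitsRev (suc N) y = fromℕ< (m%n<n y 10) ∷ toDigitsRev N (y / 10)

toDigits : (N : ℕ) → ℕ → Digits N
toDigits N y = reverse (toDigitsRev N y)

ball : (N : ℕ) → Digits N → ℕ
ball N x =
  let y  = ∣ value x - value (reverse x) ∣
      y' = value (reverse (toDigits N y))
  in y + y'

-- B is a Ball magic number: obtained from some non-palindromic x with
-- exactly N ≥ 2 decimal digits (leading digit nonzero).
IsBallMagic : ℕ → Set
IsBallMagic B =
  ∃[ M ] (2 ≤ suc M × (∃[ x ] (head {n = M} x ≢ zero × reverse x ≢ x × ball (suc M) x ≡ B)))

-- Take x = 10^n, i.e. the digit string 1 0 … 0 with N = n + 1 digits. Its reverse is 1,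
-- so y = 10^n − 1, whose N-digit string is 0 9 … 9; reversing gives 9 … 9 0 = 10 y,
-- hence B = y + 10 y = 11 (10^n − 1).
module Submission where

open import Defs
open import Data.Nat using (ℕ; zero; suc; _+_; _*_; _∸_; _^_; _<_; z≤n; s≤s; ∣_-_∣)
open import Data.Nat.Properties
  using (*-identityʳ; *-assoc; +-identityʳ; suc-injective; suc-pred; m^n≢0; m^n>0; m≤n⇒∣n-m∣≡n∸m)
open import Data.Nat.DivMod using (_/_; _%_; m%n<n; [m+kn]%n≡m%n; m<n⇒m%n≡m; +-distrib-/-∣ʳ; m<n⇒m/n≡0; m*n/n≡m)
open import Data.Nat.Divisibility using (n∣m*n)
open import Data.Nat.Tactic.RingSolver using (solve-∀)
open import Data.Fin using (Fin; toℕ; fromℕ<; #_)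
open import Data.Fin.Properties using (toℕ<n; toℕ-injective; toℕ-fromℕ<)
open import Data.Vec using ([]; _∷_; _∷ʳ_; reverse; replicate)
open import Data.Vec.Properties using (reverse-∷; reverse-involutive)
open import Data.Product using (_,_)
open import Relation.Binary.PropositionalEquality
open ≡-Reasoning

digit0 digit1 digit9 : Fin 10
digit0 = # 0
digit1 = # 1
digit9 = # 9

replicate-∷ʳ : ∀ {A : Set} k (a : A) → replicate k a ∷ʳ a ≡ a ∷ replicate k a
replicate-∷ʳ zero    a = refl
replicate-∷ʳ (suc k) a = cong (a ∷_) (replicate-∷ʳ k a)

reverse-replicate : ∀ {A : Set} k (a : A) → reverse (replicate k a) ≡ replicate k a
reverse-replicate zero    a = refl
reverse-replicate (suc k) a = begin
  reverse (a ∷ replicate k a)  ≡⟨ reverse-∷ a (replicate k a) ⟩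
  reverse (replicate k a) ∷ʳ a ≡⟨ cong (_∷ʳ a) (reverse-replicate k a) ⟩
  replicate k a ∷ʳ a           ≡⟨ replicate-∷ʳ k a ⟩
  a ∷ replicate k a            ∎

10^k≡1+[10^k∸1] : ∀ k → 10 ^ k ≡ suc (10 ^ k ∸ 1)
10^k≡1+[10^k∸1] k = sym (suc-pred (10 ^ k) {{m^n≢0 10 k}})

10^[1+k]∸1≡9+[10^k∸1]*10 : ∀ k → 10 ^ suc k ∸ 1 ≡ 9 + (10 ^ k ∸ 1) * 10
10^[1+k]∸1≡9+[10^k∸1]*10 k = begin
  10 * 10 ^ k ∸ 1 ≡⟨ cong (λ p → 10 * p ∸ 1) (10^k≡1+[10^k∸1] k) ⟩
  10 * suc t ∸ 1  ≡⟨ cong (_∸ 1) (expand t) ⟩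
  9 + t * 10      ∎
  where
  t : ℕ
  t = 10 ^ k ∸ 1
  expand : ∀ t → 10 * suc t ≡ 1 + (9 + t * 10)
  expand = solve-∀

valueAcc-∷ʳ : ∀ {N} acc (ds : Digits N) d → valueAcc acc (ds ∷ʳ d) ≡ valueAcc acc ds * 10 + toℕ d
valueAcc-∷ʳ acc []       d = refl
valueAcc-∷ʳ acc (e ∷ ds) d = valueAcc-∷ʳ (acc * 10 + toℕ e) ds d

valueAcc-zeros : ∀ k acc → valueAcc acc (replicate k digit0) ≡ acc * 10 ^ k
valueAcc-zeros zero    acc = sym (*-identityʳ acc)
valueAcc-zeros (suc k) acc = begin
  valueAcc (acc * 10 + 0) (replicate k digit0) ≡⟨ valueAcc-zeros k (acc * 10 + 0) ⟩
  (acc * 10 + 0) * 10 ^ k                      ≡⟨ cong (_* 10 ^ k) (+-identityʳ (acc * 10)) ⟩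
  acc * 10 * 10 ^ k                            ≡⟨ *-assoc acc 10 (10 ^ k) ⟩
  acc * 10 ^ suc k                             ∎

valueAcc-nines : ∀ k acc → suc (valueAcc acc (replicate k digit9)) ≡ suc acc * 10 ^ k
valueAcc-nines zero    acc = sym (*-identityʳ (suc acc))
valueAcc-nines (suc k) acc = begin
  suc (valueAcc (acc * 10 + 9) (replicate k digit9)) ≡⟨ valueAcc-nines k (acc * 10 + 9) ⟩
  suc (acc * 10 + 9) * 10 ^ k                        ≡⟨ cong (_* 10 ^ k) (carry acc) ⟩
  suc acc * 10 * 10 ^ k                              ≡⟨ *-assoc (suc acc) 10 (10 ^ k) ⟩
  suc acc * 10 ^ suc k                               ∎
  where
  carry : ∀ a → suc (a * 10 + 9) ≡ suc a * 10
  carry = solve-∀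

value-nines : ∀ k → value (replicate k digit9) ≡ 10 ^ k ∸ 1
value-nines k = suc-injective (begin
  suc (value (replicate k digit9)) ≡⟨ valueAcc-nines k 0 ⟩
  1 * 10 ^ k                       ≡⟨ +-identityʳ (10 ^ k) ⟩
  10 ^ k                           ≡⟨ 10^k≡1+[10^k∸1] k ⟩
  suc (10 ^ k ∸ 1)                 ∎)

toDigitsRev-∷ : ∀ N (d : Fin 10) y → toDigitsRev (suc N) (toℕ d + y * 10) ≡ d ∷ toDigitsRev N y
toDigitsRev-∷ N d y = cong₂ _∷_ lastDigit (cong (toDigitsRev N) quotient)
  where
  remainder : (toℕ d + y * 10) % 10 ≡ toℕ d
  remainder = trans ([m+kn]%n≡m%n (toℕ d) y 10) (m<n⇒m%n≡m (toℕ<n d))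
  lastDigit : fromℕ< (m%n<n (toℕ d + y * 10) 10) ≡ d
  lastDigit = toℕ-injective (trans (toℕ-fromℕ< _) remainder)
  quotient : (toℕ d + y * 10) / 10 ≡ y
  quotient = begin
    (toℕ d + y * 10) / 10    ≡⟨ +-distrib-/-∣ʳ (toℕ d) (n∣m*n y) ⟩
    toℕ d / 10 + y * 10 / 10 ≡⟨ cong₂ _+_ (m<n⇒m/n≡0 (toℕ<n d)) (m*n/n≡m y 10) ⟩
    y                        ∎

toDigitsRev-10^k∸1 : ∀ k → toDigitsRev (suc k) (10 ^ k ∸ 1) ≡ replicate k digit9 ∷ʳ digit0
toDigitsRev-10^k∸1 zero    = refl
toDigitsRev-10^k∸1 (suc k) = begin
  toDigitsRev (2 + k) (10 ^ suc k ∸ 1)                 ≡⟨ cong (toDigitsRev (2 + k)) (10^[1+k]∸1≡9+[10^k∸1]*10 k) ⟩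
  toDigitsRev (2 + k) (toℕ digit9 + (10 ^ k ∸ 1) * 10) ≡⟨ toDigitsRev-∷ (suc k) digit9 (10 ^ k ∸ 1) ⟩
  digit9 ∷ toDigitsRev (suc k) (10 ^ k ∸ 1)            ≡⟨ cong (digit9 ∷_) (toDigitsRev-10^k∸1 k) ⟩
  digit9 ∷ (replicate k digit9 ∷ʳ digit0)              ∎

tenToThe : (n : ℕ) → Digits (suc n)
tenToThe n = digit1 ∷ replicate n digit0

reverse-tenToThe : ∀ n → reverse (tenToThe n) ≡ replicate n digit0 ∷ʳ digit1
reverse-tenToThe n =
  trans (reverse-∷ digit1 (replicate n digit0)) (cong (_∷ʳ digit1) (reverse-replicate n digit0))

value-tenToThe : ∀ n → value (tenToThe n) ≡ 10 ^ n
value-tenToThe n = trans (valueAcc-zeros n 1) (+-identityʳ (10 ^ n))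

value-reverse-tenToThe : ∀ n → value (reverse (tenToThe n)) ≡ 1
value-reverse-tenToThe n = begin
  value (reverse (tenToThe n))         ≡⟨ cong value (reverse-tenToThe n) ⟩
  value (replicate n digit0 ∷ʳ digit1) ≡⟨ valueAcc-∷ʳ 0 (replicate n digit0) digit1 ⟩
  value (replicate n digit0) * 10 + 1  ≡⟨ cong (λ v → v * 10 + 1) (valueAcc-zeros n 0) ⟩
  1                                    ∎

tenToThe-not-palindrome : ∀ n → reverse (tenToThe (suc n)) ≢ tenToThe (suc n)
tenToThe-not-palindrome n palindrome with trans (sym (reverse-tenToThe (suc n))) palindrome
... | ()

ball-tenToThe : ∀ n → ball (suc n) (tenToThe n) ≡ 11 * (10 ^ n ∸ 1)
ball-tenToThe n = begin
  y + value (reverse (toDigits (suc n) y))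
    ≡⟨ cong (λ z → z + value (reverse (toDigits (suc n) z))) difference ⟩
  t + value (reverse (reverse (toDigitsRev (suc n) t)))
    ≡⟨ cong (λ ds → t + value ds) (reverse-involutive (toDigitsRev (suc n) t)) ⟩
  t + value (toDigitsRev (suc n) t)
    ≡⟨ cong (λ ds → t + value ds) (toDigitsRev-10^k∸1 n) ⟩
  t + value (replicate n digit9 ∷ʳ digit0)
    ≡⟨ cong (t +_) (valueAcc-∷ʳ 0 (replicate n digit9) digit0) ⟩
  t + (value (replicate n digit9) * 10 + 0)
    ≡⟨ cong (λ v → t + (v * 10 + 0)) (value-nines n) ⟩
  t + (t * 10 + 0)
    ≡⟨ collect t ⟩
  11 * t
    ∎
  where
  t y : ℕ
  t = 10 ^ n ∸ 1
  y = ∣ value (tenToThe n) - value (reverse (tenToThe n)) ∣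
  difference : y ≡ t
  difference = begin
    y              ≡⟨ cong₂ ∣_-_∣ (value-tenToThe n) (value-reverse-tenToThe n) ⟩
    ∣ 10 ^ n - 1 ∣ ≡⟨ m≤n⇒∣n-m∣≡n∸m (m^n>0 10 n) ⟩
    t              ∎
  collect : ∀ t → t + (t * 10 + 0) ≡ 11 * t
  collect = solve-∀

theorem20 : (n : ℕ) → 1 < n → IsBallMagic (11 * (10 ^ n ∸ 1))
theorem20 zero ()
theorem20 (suc n) _ =
  suc n , s≤s (s≤s z≤n) , tenToThe (suc n) , (λ ()) , tenToThe-not-palindrome n , ball-tenToThe (suc n)
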